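{- Let $\Theta$ be an open saturated branch of a tableau of $\mathbf{TAB}_{\mathbf{IB}}$, let $i$ be an identity urfather on $\Theta$, and let $\varphi$ be a formula such that $@_i\varphi$ is a quasi-subformula of the root formula of $\Theta$. Then $\mathcal{M}^\Theta, i\models\varphi$ if and only if $\mathcal{M}^\Theta_B, i_B\models\varphi$, where $i_B=(i,0)$ if $i\in W^\Theta_r$ and $i_B=i$ otherwise.
   Context: Hybrid language: fix disjoint countably infinite sets $\mathbf{Prop}$ (propositional variables) and $\mathbf{Nom}$ (nominals). Formulas: $\varphi ::= p \mid i \mid \neg\varphi \mid \varphi\land\varphi \mid \diamondsuit\varphi \mid @_i\varphi$ with $p\in\mathbf{Prop}$, $i\in\mathbf{Nom}$; $\square\varphi$ abbreviates $\neg\diamondsuit\neg\varphi$. A model is $(W,R,V)$ with $W\neq\emptyset$, $R\subseteq W\times W$, $V:\mathbf{Prop}\cup\mathbf{Nom}\to\mathcal{P}(W)$ with $V(i)=\{i^V\}$ a singleton for each nominal $i$. Satisfaction: $w\models p$ iff $w\in V(p)$; $w\models i$ iff $w=i^V$; Boolean clauses as usual; $w\models\diamondsuit\varphi$ iff some $v$ with $wRv$ has $v\models\varphi$; $w\models @_i\varphi$ iff $i^V\models\varphi$. Tableaux of $\mathbf{TAB}_{\mathbf{IB}}$: a tableau is a well-founded tree of formulas of the form $@_i\varphi$, started from a root formula $@_i\varphi$ where $i$ does not occur in $\varphi$. Each branch (maximal path) is extended by applying the rules below as often as possible, except that nothing more is added to a branch once it is closed, or once every formula that any rule could generate already occurs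 on it. A branch $\Theta$ is closed if $@_i\varphi, @_i\neg\varphi\in\Theta$ for some $i,\varphi$, open otherwise, and saturated if every formula that any rule could generate from it already occurs in $\Theta$. Rules (premises already on the branch, conclusions added to it): [$\neg\neg$] from $@_i\neg\neg\varphi$ add $@_i\varphi$; [$\land$] from $@_i(\varphi\land\psi)$ add $@_i\varphi$ and $@_i\psi$; [$\neg\land$] from $@_i\neg(\varphi\land\psi)$ split the branch into one branch with $@_i\neg\varphi$ and one with $@_i\neg\psi$; [$\diamondsuit$] from $@_i\diamondsuit\varphi$ add $@_i\diamondsuit j$ and $@_j\varphi$, where $j$ is a nominal not yet occurring on the branch, the rule is applied at most once per formula, the premise is not an accessibility formula, and (restriction $\mathcal{D}$) $i$ is a quasi-urfather on the branch; [$\neg\diamondsuit$] from $@_i\neg\diamondsuit\varphi$ and $@_i\diamondsuit j$ add $@_j\neg\varphi$; [$@$] from $@_i@_j\varphi$ add $@_j\varphi$; [$\neg@$] from $@_i\neg@_j\varphi$ add $@_j\neg\varphi$; [$\mathit{Id}$] from $@_i\varphi$ and $@_i j$ add $@_j\varphi$, provided $@_i\varphi$ is not an accessibility formula; [$\mathit{Ref}$] add $@_i i$ for any nominal $i$ occurring on the branch; [$\square_{\mathit{sym}}$] from $@_i\square\varphi$ and $@_j\diamondsuit i$ add $@_j\varphi$; ($\mathcal{I}$) for every nominal $i$ occurring on the branch add $@_i\neg\diamondsuit i$. An accessibility formula is a formula $@_i\diamondsuit j$ added by [$\diamondsuit$] with $j$ new. Auxiliary notions for a branch $\Theta$: $@_i\varphi$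 is a quasi-subformula of $@_j\psi$ if $\varphi$ is a subformula of $\psi$, or $\varphi=\neg\chi$ with $\chi$ a subformula of $\psi$. $T^\Theta(i)=\{\varphi \mid @_i\varphi\in\Theta$ and $@_i\varphi$ is a quasi-subformula of the root formula$\}$. Nominals $i,j$ are twins in $\Theta$ if $T^\Theta(i)=T^\Theta(j)$. $i\prec_\Theta j$ if $j$ was introduced by applying [$\diamondsuit$] to a formula $@_i\diamondsuit\varphi$; $\prec_\Theta^*$ is its reflexive transitive closure. A nominal $i$ is a quasi-urfather on $\Theta$ if there are no twins $j\neq k$ with $j\prec_\Theta^* i$ and $k\prec_\Theta^* i$. The identity urfather $v_\Theta(i)$ of a nominal $i$ occurring in $\Theta$ is the earliest introduced nominal $j$ on $\Theta$ that is a twin of $i$ and a quasi-urfather on $\Theta$, if such $j$ exists; $\mathrm{dom}(v_\Theta)$ is the set of nominals $i$ for which $v_\Theta(i)$ exists; $i$ is called an identity urfather if $v_\Theta(i)=i$. The model $\mathcal{M}^\Theta=(W^\Theta,R^\Theta,V^\Theta)$ of an open saturated branch $\Theta$ with root formula $@_{i_0}\varphi_0$: $W^\Theta$ is the set of identity urfathers on $\Theta$; $R^\Theta=\{(v_\Theta(i),v_\Theta(j)) \mid @_i\diamondsuit j\in\Theta,\ i,j\in\mathrm{dom}(v_\Theta)\}\cup\{(v_\Theta(j),v_\Theta(i)) \mid @_i\diamondsuit j\in\Theta,\ i,j\in\mathrm{dom}(v_\Theta)\}$; $V^\Theta(p)=\{v_\Theta(i)\mid @_i p\in\Theta\}$ for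 $p\in\mathbf{Prop}$; for $i\in\mathbf{Nom}$, $V^\Theta(i)=\{v_\Theta(i)\}$ if $i\in\mathrm{dom}(v_\Theta)$ and $V^\Theta(i)=\{i_0\}$ otherwise. $W^\Theta_r=\{w\in W^\Theta\mid wR^\Theta w\}$. Bulldozed model: for a model $\mathcal{M}=(W,R,V)$, let $W_r=\{w\in W\mid wRw\}$, $W^-=W\setminus W_r$, and $W_B=W^-\cup\{(w,n)\mid w\in W_r,\ n\in\{0,1\}\}$. Define $\alpha:W_B\to W$ by $\alpha(w)=w$ for $w\in W^-$ and $\alpha((w,n))=w$. Put $wR_Bv$ iff one of: (1) $w\in W^-$ or $v\in W^-$, and $\alpha(w)R\alpha(v)$; (2) $w=(w',m)$, $v=(v',n)$, $w'\neq v'$ and $w'Rv'$; (3) $w\neq v$ and $\alpha(w)=\alpha(v)$. Put $w\in V_B(p)$ iff $\alpha(w)\in V(p)$ for $p\in\mathbf{Prop}$; for $i\in\mathbf{Nom}$, $V_B(i)=\{(i^V,0)\}$ if $i^V\in W_r$ and $V_B(i)=V(i)$ otherwise. $\mathcal{M}_B=(W_B,R_B,V_B)$. $\mathcal{M}^\Theta_B$ denotes the bulldozed model of $\mathcal{M}^\Theta$. -}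

module Defs where

open import Data.Nat using (ℕ; zero; suc; _<_)
open import Data.Bool using (Bool; true; false)
open import Data.Product using (Σ; ∃; proj₁; proj₂; ∃-syntax; _×_; _,_)
open import Data.Sum using (_⊎_)
open import Data.Empty using (⊥)
open import Data.Unit using (⊤)
open import Data.List using (List; []; _∷_; _++_; [_]; concatMap)
open import Data.List.Relation.Unary.All using (All)
open import Data.List.Membership.Propositional using (_∈_)
open import Relation.Nullary using (¬_)
open import Relation.Binary.PropositionalEquality using (_≡_; _≢_)
open import Relation.Binary.Construct.Closure.ReflexiveTransitive using (Star)
open import Function.Bundles using (_⇔_)

infixr 6 _∧ᶠ_

data Form : Set where
  pv   : ℕ → Form
  nm   : ℕ → Form
  ¬ᶠ_  : Form → Form
  _∧ᶠ_ : Form → Form → Form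
  ◇ᶠ_  : Form → Form
  at   : ℕ → Form → Form

□ᶠ_ : Form → Form
□ᶠ φ = ¬ᶠ (◇ᶠ (¬ᶠ φ))

data Sub (φ : Form) : Form → Set where
  sub-refl : Sub φ φ
  sub-¬    : ∀ {ψ} → Sub φ ψ → Sub φ (¬ᶠ ψ)
  sub-∧ˡ   : ∀ {ψ χ} → Sub φ ψ → Sub φ (ψ ∧ᶠ χ)
  sub-∧ʳ   : ∀ {ψ χ} → Sub φ χ → Sub φ (ψ ∧ᶠ χ)
  sub-◇    : ∀ {ψ} → Sub φ ψ → Sub φ (◇ᶠ ψ)
  sub-at   : ∀ {j ψ} → Sub φ ψ → Sub φ (at j ψ)

nomsF : Form → List ℕ
nomsF (pv p)    = []
nomsF (nm i)    = i ∷ []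
nomsF (¬ᶠ φ)    = nomsF φ
nomsF (φ ∧ᶠ ψ)  = nomsF φ ++ nomsF ψ
nomsF (◇ᶠ φ)    = nomsF φ
nomsF (at i φ)  = i ∷ nomsF φ

-- Semantics.  A model (W,R,V); the valuation of a nominal is given as a
-- subset N i ⊆ W (the constructions below make it a singleton).

record Model : Set₁ where
  field
    W : Set
    R : W → W → Set
    V : ℕ → W → Set
    N : ℕ → W → Set

module _ (M : Model) where
  open Model M
  _⊨_ : W → Form → Set
  w ⊨ pv p     = V p w
  w ⊨ nm i     = N i w
  w ⊨ (¬ᶠ φ)   = ¬ (w ⊨ φ)
  w ⊨ (φ ∧ᶠ ψ) = (w ⊨ φ) × (w ⊨ ψ)
  w ⊨ (◇ᶠ φ)   = ∃[ v ] (R w v × (v ⊨ φ))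
  w ⊨ at i φ   = ∃[ v ] (N i v × (v ⊨ φ))

-- Bulldozing.  W_B = W⁻ ∪ (W_r × {0,1}); 0 is 'false', 1 is 'true'.

module Bulldoze (M : Model) where
  open Model M

  data WB : Set where
    minus : (w : W) → .(¬ R w w) → WB
    pair  : (w : W) → .(R w w) → Bool → WB

  α : WB → W
  α (minus w _)  = w
  α (pair w _ _) = w

  IsMinus : WB → Set
  IsMinus (minus _ _)  = ⊤
  IsMinus (pair _ _ _) = ⊥

  Clause2 : WB → WB → Set
  Clause2 (pair w _ _) (pair v _ _) = (w ≢ v) × R w v
  Clause2 _ _ = ⊥

  RB : WB → WB → Set
  RB x y = ((IsMinus x ⊎ IsMinus y) × R (α x) (α y))
         ⊎ Clause2 x y
         ⊎ ((x ≢ y) × (α x ≡ α y))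

  NB : ℕ → WB → Set
  NB i (minus w _)  = N i w
  NB i (pair w _ b) = N i w × (b ≡ false)

  MB : Model
  MB = record { W = WB ; R = RB ; V = λ p x → V p (α x) ; N = NB }

  -- x is i_B for the world w = i^V:  (w,0) if w ∈ W_r, w otherwise
  IsB : W → WB → Set
  IsB w x = (Σ (R w w) λ r → x ≡ pair w r false) ⊎ (Σ (¬ R w w) λ nr → x ≡ minus w nr)

-- Tableaux of TAB_IB.  A labelled formula (i , φ) stands for @_i φ.

LF : Set
LF = ℕ × Form

nomsLF : LF → List ℕ
nomsLF (i , φ) = i ∷ nomsF φ

-- @_i φ is a quasi-subformula of the root @_{i0} φ0
QSub : Form → Form → Set
QSub φ φ0 = Sub φ φ0 ⊎ (∃[ χ ] (φ ≡ ¬ᶠ χ × Sub χ φ0))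

data Rule : Set where
  r¬¬   : ℕ → Form → Rule
  r∧    : ℕ → Form → Form → Rule
  r¬∧   : ℕ → Form → Form → Bool → Rule
  r◇    : ℕ → Form → ℕ → Rule
  r¬◇   : ℕ → Form → ℕ → Rule
  rAt    : ℕ → ℕ → Form → Rule
  r¬At   : ℕ → ℕ → Form → Rule
  rId   : ℕ → Form → ℕ → Rule
  rRef  : ℕ → Rule
  r□sym : ℕ → Form → ℕ → Rule
  rI    : ℕ → Rule

concl : Rule → List LF
concl (r¬¬ i φ)         = (i , φ) ∷ []
concl (r∧ i φ ψ)        = (i , φ) ∷ (i , ψ) ∷ []
concl (r¬∧ i φ ψ true)  = (i , ¬ᶠ φ) ∷ []
concl (r¬∧ i φ ψ false) = (i , ¬ᶠ ψ) ∷ []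
concl (r◇ i φ j)        = (i , ◇ᶠ nm j) ∷ (j , φ) ∷ []
concl (r¬◇ i φ j)       = (j , ¬ᶠ φ) ∷ []
concl (rAt i j φ)        = (j , φ) ∷ []
concl (r¬At i j φ)       = (j , ¬ᶠ φ) ∷ []
concl (rId i φ j)       = (j , φ) ∷ []
concl (rRef i)          = (i , nm i) ∷ []
concl (r□sym i φ j)     = (j , φ) ∷ []
concl (rI i)            = (i , ¬ᶠ (◇ᶠ nm i)) ∷ []

-- Everything below is relative to the root formula @_{i0} φ0 (root = (i0 , φ0))
-- and the sequence ρ of rule applications performed so far on the branch.
module _ (root : LF) where

  rootBody : Form
  rootBody = proj₂ root

  rootNom : ℕ
  rootNom = proj₁ root

  module _ (ρ : List Rule) where

    Θ : List LF
    Θ = root ∷ concatMap concl ρ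

    nomSeq : List ℕ
    nomSeq = concatMap nomsLF Θ

    Occurs : ℕ → Set
    Occurs j = j ∈ nomSeq

    Closed : Set
    Closed = ∃[ i ] ∃[ φ ] ((i , φ) ∈ Θ × (i , ¬ᶠ φ) ∈ Θ)

    IsAcc : LF → Set
    IsAcc (i , φ) = ∃[ j ] ∃[ ψ ] (φ ≡ ◇ᶠ nm j × r◇ i ψ j ∈ ρ)

    T : ℕ → Form → Set
    T i φ = (i , φ) ∈ Θ × QSub φ rootBody

    Twins : ℕ → ℕ → Set
    Twins i j = ∀ φ → T i φ ⇔ T j φ

    _≺_ : ℕ → ℕ → Set
    i ≺ j = ∃[ φ ] (r◇ i φ j ∈ ρ)

    _≺*_ : ℕ → ℕ → Set
    _≺*_ = Star _≺_

    QuasiUrfather : ℕ → Set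
    QuasiUrfather i = ¬ (∃[ j ] ∃[ k ] (j ≢ k × Twins j k × j ≺* i × k ≺* i))

    data FirstAt : List ℕ → ℕ → ℕ → Set where
      here  : ∀ {j l} → FirstAt (j ∷ l) j zero
      there : ∀ {k j l n} → k ≢ j → FirstAt l j n → FirstAt (k ∷ l) j (suc n)

    Earlier : ℕ → ℕ → Set
    Earlier j k = ∃[ m ] ∃[ n ] (FirstAt nomSeq j m × FirstAt nomSeq k n × m < n)

    IsV : ℕ → ℕ → Set
    IsV i j = Occurs i × Occurs j × Twins i j × QuasiUrfather j
            × (∀ k → Occurs k → Twins i k → QuasiUrfather k → k ≢ j → Earlier j k)

    InDom : ℕ → Set
    InDom i = ∃[ j ] IsV i j

    IdentityUrfather : ℕ → Set
    IdentityUrfather i = IsV i i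

    Applicable : Rule → Set
    Applicable (r¬¬ i φ)       = (i , ¬ᶠ (¬ᶠ φ)) ∈ Θ
    Applicable (r∧ i φ ψ)      = (i , φ ∧ᶠ ψ) ∈ Θ
    Applicable (r¬∧ i φ ψ b)   = (i , ¬ᶠ (φ ∧ᶠ ψ)) ∈ Θ
    Applicable (r◇ i φ j)      = (i , ◇ᶠ φ) ∈ Θ × ¬ Occurs j
                                 × ¬ (∃[ k ] (r◇ i φ k ∈ ρ))
                                 × ¬ IsAcc (i , ◇ᶠ φ)
                                 × QuasiUrfather i
    Applicable (r¬◇ i φ j)     = (i , ¬ᶠ (◇ᶠ φ)) ∈ Θ × (i , ◇ᶠ nm j) ∈ Θ
    Applicable (rAt i j φ)      = (i , at j φ) ∈ Θ
    Applicable (r¬At i j φ)     = (i , ¬ᶠ (at j φ)) ∈ Θ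
    Applicable (rId i φ j)     = (i , φ) ∈ Θ × (i , nm j) ∈ Θ × ¬ IsAcc (i , φ)
    Applicable (rRef i)        = Occurs i
    Applicable (r□sym i φ j)   = (i , □ᶠ φ) ∈ Θ × (j , ◇ᶠ nm i) ∈ Θ
    Applicable (rI i)          = Occurs i

    AlreadyThere : Rule → Set
    AlreadyThere (r¬∧ i φ ψ _) = (i , ¬ᶠ φ) ∈ Θ ⊎ (i , ¬ᶠ ψ) ∈ Θ
    AlreadyThere r             = All (_∈ Θ) (concl r)

    Saturated : Set
    Saturated = ∀ r → Applicable r → AlreadyThere r

  -- Tableaux (well-founded = inductive) extended as long as possible
  data Tableau (ρ : List Rule) : Set where
    leaf  : Closed ρ ⊎ Saturated ρ → Tableau ρ
    step  : (r : Rule) → (∀ i φ ψ b → r ≢ r¬∧ i φ ψ b) → Applicable ρ r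
          → ¬ Closed ρ → ¬ Saturated ρ → Tableau (ρ ++ [ r ]) → Tableau ρ
    split : ∀ i φ ψ → Applicable ρ (r¬∧ i φ ψ true) → ¬ Closed ρ → ¬ Saturated ρ
          → Tableau (ρ ++ [ r¬∧ i φ ψ true ]) → Tableau (ρ ++ [ r¬∧ i φ ψ false ])
          → Tableau ρ

  data BranchOf : {ρ : List Rule} → Tableau ρ → List Rule → Set where
    b-leaf  : ∀ {ρ} c → BranchOf {ρ} (leaf c) ρ
    b-step  : ∀ {ρ r n a c s t σ} → BranchOf t σ → BranchOf {ρ} (step r n a c s t) σ
    b-left  : ∀ {ρ i φ ψ a c s t u σ} → BranchOf t σ → BranchOf {ρ} (split i φ ψ a c s t u) σ
    b-right : ∀ {ρ i φ ψ a c s t u σ} → BranchOf u σ → BranchOf {ρ} (split i φ ψ a c s t u) σ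

  module _ (σ : List Rule) where

    record WΘ : Set where
      constructor world
      field
        nomOf : ℕ
        .isU  : IdentityUrfather σ nomOf
    open WΘ public

    RΘ : WΘ → WΘ → Set
    RΘ w v = ∃[ i ] ∃[ j ] ((i , ◇ᶠ nm j) ∈ Θ σ ×
               ((IsV σ i (nomOf w) × IsV σ j (nomOf v))
                ⊎ (IsV σ j (nomOf w) × IsV σ i (nomOf v))))

    VΘ : ℕ → WΘ → Set
    VΘ p w = ∃[ i ] ((i , pv p) ∈ Θ σ × IsV σ i (nomOf w))

    NΘ : ℕ → WΘ → Set
    NΘ j w = IsV σ j (nomOf w) ⊎ (¬ InDom σ j × nomOf w ≡ rootNom)

    MΘ : Model
    MΘ = record { W = WΘ ; R = RΘ ; V = VΘ ; N = NΘ }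

module Submission where

-- The projection α : W_B → W is a bounded morphism: a reflexive world w is replaced by two
-- copies that see each other and everything w sees.  So α preserves the truth of every
-- formula, except that a nominal naming a reflexive world w holds at (w,0) but fails at
-- (w,1).  On an open saturated branch no nominal of the root formula names a reflexive world
-- of M^Θ: the root nominals are never introduced by [◇], hence are quasi-urfathers and lie in
-- dom v_Θ; and if k were twin of both ends of some @_a ◇b, then (I) gives @_k ¬◇k, Id moves it
-- to a, and [¬◇] yields @_b ¬k, while b inherits @_b k from its twin k.  Constructively one
-- also needs M^Θ to have decidable reflexivity, to choose the copy of a successor; it does,
-- since twinhood is decided by inspecting the finite branch.

open import Defs
open import Data.Nat using (ℕ; zero; suc; _<_; _≟_)
open import Data.Nat.Properties using (<-cmp; _<?_)
open import Data.Nat.Induction using (<-rec)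
open import Data.Bool using (true; false; not)
open import Data.Product using (∃-syntax; _×_; _,_; proj₁; proj₂; uncurry)
open import Data.Product.Function.NonDependent.Propositional using (_×-⇔_)
open import Data.Sum using (inj₁; inj₂; [_,_]′)
open import Data.Empty using (⊥-elim; ⊥-elim-irr)
open import Data.Unit using (tt)
open import Data.List using (List; []; _∷_; _++_; [_])
open import Data.List.Membership.Propositional using (_∈_; _∉_; find; lose)
open import Data.List.Membership.Propositional.Properties using (∈-++⁺ˡ; ∈-++⁺ʳ; ∈-++⁻)
open import Data.List.Membership.DecPropositional _≟_ using (_∈?_)
open import Data.List.Relation.Unary.Any using (Any; here; there; any?)
open import Data.List.Relation.Unary.All as All using (all?)
open import Relation.Nullary using (¬_; Dec; yes; no)
open import Relation.Nullary.Decidable using (map′; recompute; _×-dec_; _⊎-dec_; _→-dec_)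
open import Relation.Nullary.Recomputable using (Recomputable; ¬-recompute)
open import Relation.Binary.Definitions using (Decidable; DecidableEquality; tri<; tri≈; tri>)
open import Relation.Binary.Construct.Closure.ReflexiveTransitive using (ε; _◅_)
open import Relation.Binary.PropositionalEquality using (_≡_; _≢_; refl; sym; trans; cong; cong₂; subst; subst₂)
open import Function using (id)
open import Function.Bundles using (_⇔_; mk⇔; Equivalence)
open import Function.Related.TypeIsomorphisms using (¬-cong-⇔)
open import Function.Construct.Identity using (⇔-id)
open import Function.Construct.Symmetry using (⇔-sym)
open import Function.Construct.Composition using (_⇔-∘_)

infix 4 _≟ᶠ_

_≟ᶠ_ : DecidableEquality Form
pv p      ≟ᶠ pv q      = map′ (cong pv) (λ { refl → refl }) (p ≟ q)
nm i      ≟ᶠ nm j      = map′ (cong nm) (λ { refl → refl }) (i ≟ j)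
(¬ᶠ φ)    ≟ᶠ (¬ᶠ ψ)    = map′ (cong ¬ᶠ_) (λ { refl → refl }) (φ ≟ᶠ ψ)
(φ ∧ᶠ φ′) ≟ᶠ (ψ ∧ᶠ ψ′) = map′ (uncurry (cong₂ _∧ᶠ_)) (λ { refl → refl , refl })
                               (φ ≟ᶠ ψ ×-dec φ′ ≟ᶠ ψ′)
(◇ᶠ φ)    ≟ᶠ (◇ᶠ ψ)    = map′ (cong ◇ᶠ_) (λ { refl → refl }) (φ ≟ᶠ ψ)
at i φ    ≟ᶠ at j ψ    = map′ (uncurry (cong₂ at)) (λ { refl → refl , refl }) (i ≟ j ×-dec φ ≟ᶠ ψ)
pv _      ≟ᶠ nm _      = no λ ()
pv _      ≟ᶠ ¬ᶠ _      = no λ ()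
pv _      ≟ᶠ _ ∧ᶠ _    = no λ ()
pv _      ≟ᶠ ◇ᶠ _      = no λ ()
pv _      ≟ᶠ at _ _    = no λ ()
nm _      ≟ᶠ pv _      = no λ ()
nm _      ≟ᶠ ¬ᶠ _      = no λ ()
nm _      ≟ᶠ _ ∧ᶠ _    = no λ ()
nm _      ≟ᶠ ◇ᶠ _      = no λ ()
nm _      ≟ᶠ at _ _    = no λ ()
(¬ᶠ _)    ≟ᶠ pv _      = no λ ()
(¬ᶠ _)    ≟ᶠ nm _      = no λ ()
(¬ᶠ _)    ≟ᶠ _ ∧ᶠ _    = no λ ()
(¬ᶠ _)    ≟ᶠ ◇ᶠ _      = no λ ()
(¬ᶠ _)    ≟ᶠ at _ _    = no λ ()
(_ ∧ᶠ _)  ≟ᶠ pv _      = no λ ()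
(_ ∧ᶠ _)  ≟ᶠ nm _      = no λ ()
(_ ∧ᶠ _)  ≟ᶠ ¬ᶠ _      = no λ ()
(_ ∧ᶠ _)  ≟ᶠ ◇ᶠ _      = no λ ()
(_ ∧ᶠ _)  ≟ᶠ at _ _    = no λ ()
(◇ᶠ _)    ≟ᶠ pv _      = no λ ()
(◇ᶠ _)    ≟ᶠ nm _      = no λ ()
(◇ᶠ _)    ≟ᶠ ¬ᶠ _      = no λ ()
(◇ᶠ _)    ≟ᶠ _ ∧ᶠ _    = no λ ()
(◇ᶠ _)    ≟ᶠ at _ _    = no λ ()
at _ _    ≟ᶠ pv _      = no λ ()
at _ _    ≟ᶠ nm _      = no λ ()
at _ _    ≟ᶠ ¬ᶠ _      = no λ ()
at _ _    ≟ᶠ _ ∧ᶠ _    = no λ ()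
at _ _    ≟ᶠ ◇ᶠ _      = no λ ()

_≟ˡ_ : DecidableEquality LF
(i , φ) ≟ˡ (j , ψ) = map′ (uncurry (cong₂ _,_)) (λ { refl → refl , refl }) (i ≟ j ×-dec φ ≟ᶠ ψ)

open import Data.List.Membership.DecPropositional _≟ˡ_ using () renaming (_∈?_ to _∈ˡ?_)

sub-trans : ∀ {φ ψ χ} → Sub φ ψ → Sub ψ χ → Sub φ χ
sub-trans s sub-refl   = s
sub-trans s (sub-¬ t)  = sub-¬ (sub-trans s t)
sub-trans s (sub-∧ˡ t) = sub-∧ˡ (sub-trans s t)
sub-trans s (sub-∧ʳ t) = sub-∧ʳ (sub-trans s t)
sub-trans s (sub-◇ t)  = sub-◇ (sub-trans s t)
sub-trans s (sub-at t) = sub-at (sub-trans s t)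

≡⇒sub : ∀ {φ ψ} → φ ≡ ψ → Sub φ ψ
≡⇒sub refl = sub-refl

sub? : Decidable Sub
sub? φ (pv p)   = map′ ≡⇒sub (λ { sub-refl → refl }) (φ ≟ᶠ pv p)
sub? φ (nm i)   = map′ ≡⇒sub (λ { sub-refl → refl }) (φ ≟ᶠ nm i)
sub? φ (¬ᶠ ψ)   = map′ [ ≡⇒sub , sub-¬ ]′
                       (λ { sub-refl → inj₁ refl ; (sub-¬ s) → inj₂ s })
                       (φ ≟ᶠ ¬ᶠ ψ ⊎-dec sub? φ ψ)
sub? φ (ψ ∧ᶠ χ) = map′ [ ≡⇒sub , [ sub-∧ˡ , sub-∧ʳ ]′ ]′
                       (λ { sub-refl → inj₁ refl
                          ; (sub-∧ˡ s) → inj₂ (inj₁ s)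
                          ; (sub-∧ʳ s) → inj₂ (inj₂ s) })
                       (φ ≟ᶠ ψ ∧ᶠ χ ⊎-dec sub? φ ψ ⊎-dec sub? φ χ)
sub? φ (◇ᶠ ψ)   = map′ [ ≡⇒sub , sub-◇ ]′
                       (λ { sub-refl → inj₁ refl ; (sub-◇ s) → inj₂ s })
                       (φ ≟ᶠ ◇ᶠ ψ ⊎-dec sub? φ ψ)
sub? φ (at i ψ) = map′ [ ≡⇒sub , sub-at ]′
                       (λ { sub-refl → inj₁ refl ; (sub-at s) → inj₂ s })
                       (φ ≟ᶠ at i ψ ⊎-dec sub? φ ψ)

negated-sub? : ∀ φ φ0 → Dec (∃[ χ ] (φ ≡ ¬ᶠ χ × Sub χ φ0))
negated-sub? (¬ᶠ χ)   φ0 = map′ (λ s → χ , refl , s) (λ { (_ , refl , s) → s }) (sub? χ φ0)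
negated-sub? (pv _)   _  = no λ { (_ , () , _) }
negated-sub? (nm _)   _  = no λ { (_ , () , _) }
negated-sub? (_ ∧ᶠ _) _  = no λ { (_ , () , _) }
negated-sub? (◇ᶠ _)   _  = no λ { (_ , () , _) }
negated-sub? (at _ _) _  = no λ { (_ , () , _) }

qsub? : Decidable QSub
qsub? φ φ0 = sub? φ φ0 ⊎-dec negated-sub? φ φ0

qsub-nominal : ∀ {k φ φ0} → QSub φ φ0 → Sub (nm k) φ → Sub (nm k) φ0
qsub-nominal (inj₁ φ⊑φ0)              k⊑φ         = sub-trans k⊑φ φ⊑φ0
qsub-nominal (inj₂ (_ , refl , χ⊑φ0)) (sub-¬ k⊑χ) = sub-trans k⊑χ χ⊑φ0

nominal-sub⇒∈nomsF : ∀ {k φ} → Sub (nm k) φ → k ∈ nomsF φ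
nominal-sub⇒∈nomsF sub-refl                = here refl
nominal-sub⇒∈nomsF (sub-¬ s)               = nominal-sub⇒∈nomsF s
nominal-sub⇒∈nomsF (sub-∧ˡ s)              = ∈-++⁺ˡ (nominal-sub⇒∈nomsF s)
nominal-sub⇒∈nomsF {φ = ψ ∧ᶠ _} (sub-∧ʳ s) = ∈-++⁺ʳ (nomsF ψ) (nominal-sub⇒∈nomsF s)
nominal-sub⇒∈nomsF (sub-◇ s)               = nominal-sub⇒∈nomsF s
nominal-sub⇒∈nomsF (sub-at s)              = there (nominal-sub⇒∈nomsF s)

module _ (M : Model) where
  open Model M

  NamesIrreflexive : ℕ → Set
  NamesIrreflexive k = ∀ w → N k w → ¬ R w w

  NominalsIrreflexive : Form → Set
  NominalsIrreflexive χ = ∀ k → Sub (nm k) χ → NamesIrreflexive k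

  nominalsIrreflexive-sub : ∀ {ψ χ} → Sub ψ χ → NominalsIrreflexive χ → NominalsIrreflexive ψ
  nominalsIrreflexive-sub ψ⊑χ irr k k⊑ψ = irr k (sub-trans k⊑ψ ψ⊑χ)

  open Bulldoze M using (α; IsB)

  α-IsB : ∀ {w x} → IsB w x → α x ≡ w
  α-IsB (inj₁ (_ , refl)) = refl
  α-IsB (inj₂ (_ , refl)) = refl

module BulldozeTruth (M : Model) (_≟ʷ_ : DecidableEquality (Model.W M))
                     (reflexive? : ∀ w → Dec (Model.R M w w)) where
  open Model M
  open Bulldoze M

  infix 4 _⊨ᴹ_ _⊨ᴮ_

  _⊨ᴹ_ : W → Form → Set
  _⊨ᴹ_ = _⊨_ M

  _⊨ᴮ_ : WB → Form → Set
  _⊨ᴮ_ = _⊨_ MB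

  R⇒RB : ∀ x {v} → R (α x) v → ∃[ y ] (RB x y × α y ≡ v)
  R⇒RB (minus w _) {v} wRv with reflexive? v
  ... | yes vRv = pair v vRv false , inj₁ (inj₁ tt , wRv) , refl
  ... | no ¬vRv = minus v ¬vRv , inj₁ (inj₁ tt , wRv) , refl
  R⇒RB (pair w wRw b) {v} wRv with w ≟ʷ v | reflexive? v
  ... | yes refl | _       = pair w wRw (not b) , inj₂ (inj₂ (flip≢ b , refl)) , refl
    where
      flip≢ : ∀ b → pair w wRw b ≢ pair w wRw (not b)
      flip≢ true  ()
      flip≢ false ()
  ... | no w≢v   | yes vRv = pair v vRv false , inj₂ (inj₁ (w≢v , wRv)) , refl
  ... | no _     | no ¬vRv = minus v ¬vRv , inj₁ (inj₂ tt , wRv) , refl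

  RB⇒R : ∀ x y → RB x y → R (α x) (α y)
  RB⇒R _              _              (inj₁ (_ , αxRαy))         = αxRαy
  RB⇒R (pair _ _ _)   (pair _ _ _)   (inj₂ (inj₁ (_ , wRv)))    = wRv
  RB⇒R (minus _ _)    _              (inj₂ (inj₁ ()))
  RB⇒R (pair _ _ _)   (minus _ _)    (inj₂ (inj₁ ()))
  RB⇒R (pair w wRw _) _              (inj₂ (inj₂ (_ , w≡αy)))   = subst (R w) w≡αy (recompute (reflexive? w) wRw)
  RB⇒R (minus _ _)    (minus _ _)    (inj₂ (inj₂ (x≢y , refl))) = ⊥-elim (x≢y refl)
  RB⇒R (minus _ ¬wRw) (pair _ wRw _) (inj₂ (inj₂ (_ , refl)))   = ⊥-elim-irr (¬wRw wRw)

  N⇒NB : ∀ {k v} → N k v → ∃[ y ] (NB k y × α y ≡ v)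
  N⇒NB {v = v} n with reflexive? v
  ... | yes vRv = pair v vRv false , (n , refl) , refl
  ... | no ¬vRv = minus v ¬vRv , n , refl

  NB⇒N : ∀ {k} y → NB k y → N k (α y)
  NB⇒N (minus _ _)  n       = n
  NB⇒N (pair _ _ _) (n , _) = n

  ⊨-bulldoze : ∀ χ → NominalsIrreflexive M χ → ∀ x → α x ⊨ᴹ χ ⇔ x ⊨ᴮ χ
  ⊨-bulldoze (pv p)   _   x              = mk⇔ id id
  ⊨-bulldoze (nm k)   _   (minus _ _)    = mk⇔ id id
  ⊨-bulldoze (nm k)   irr (pair w wRw _) =
    mk⇔ (λ n → n , ⊥-elim (irr k sub-refl w n (recompute (reflexive? w) wRw))) proj₁
  ⊨-bulldoze (¬ᶠ χ)   irr x =
    ¬-cong-⇔ (⊨-bulldoze χ (nominalsIrreflexive-sub M (sub-¬ sub-refl) irr) x)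
  ⊨-bulldoze (χ ∧ᶠ ψ) irr x =
    ⊨-bulldoze χ (nominalsIrreflexive-sub M (sub-∧ˡ sub-refl) irr) x
      ×-⇔ ⊨-bulldoze ψ (nominalsIrreflexive-sub M (sub-∧ʳ sub-refl) irr) x
  ⊨-bulldoze (◇ᶠ χ)   irr x = mk⇔ forth back
    where
      IH : ∀ y → α y ⊨ᴹ χ ⇔ y ⊨ᴮ χ
      IH = ⊨-bulldoze χ (nominalsIrreflexive-sub M (sub-◇ sub-refl) irr)
      forth : α x ⊨ᴹ ◇ᶠ χ → x ⊨ᴮ ◇ᶠ χ
      forth (v , αxRv , v⊨χ) with R⇒RB x αxRv
      ... | y , xRy , refl = y , xRy , Equivalence.to (IH y) v⊨χ
      back : x ⊨ᴮ ◇ᶠ χ → α x ⊨ᴹ ◇ᶠ χ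
      back (y , xRy , y⊨χ) = α y , RB⇒R x y xRy , Equivalence.from (IH y) y⊨χ
  ⊨-bulldoze (at k χ) irr x = mk⇔ forth back
    where
      IH : ∀ y → α y ⊨ᴹ χ ⇔ y ⊨ᴮ χ
      IH = ⊨-bulldoze χ (nominalsIrreflexive-sub M (sub-at sub-refl) irr)
      forth : α x ⊨ᴹ at k χ → x ⊨ᴮ at k χ
      forth (v , kv , v⊨χ) with N⇒NB kv
      ... | y , ky , refl = y , ky , Equivalence.to (IH y) v⊨χ
      back : x ⊨ᴮ at k χ → α x ⊨ᴹ at k χ
      back (y , ky , y⊨χ) = α y , NB⇒N y ky , Equivalence.from (IH y) y⊨χ

module _ (i0 : ℕ) (φ0 : Form) where
  private
    root : LF
    root = i0 , φ0

  root-nominal-occurs : ∀ ρ {k} → k ∈ nomsF φ0 → Occurs root ρ k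
  root-nominal-occurs _ k∈φ0 = there (∈-++⁺ˡ k∈φ0)

  RootNominalsNotIntroduced : List Rule → Set
  RootNominalsNotIntroduced ρ = ∀ i ψ j → r◇ i ψ j ∈ ρ → j ∉ nomsF φ0

  rootNominalsNotIntroduced-++ : ∀ {ρ r} → RootNominalsNotIntroduced ρ
                               → (∀ {i ψ j} → r◇ i ψ j ≡ r → j ∉ nomsF φ0)
                               → RootNominalsNotIntroduced (ρ ++ [ r ])
  rootNominalsNotIntroduced-++ {ρ} fresh fresh-r i ψ j r◇∈ with ∈-++⁻ ρ r◇∈
  ... | inj₁ r◇∈ρ      = fresh i ψ j r◇∈ρ
  ... | inj₂ (here eq) = fresh-r eq

  branch-rootNominalsNotIntroduced : ∀ {ρ} {t : Tableau root ρ} {σ} → BranchOf root t σ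
                                   → RootNominalsNotIntroduced ρ → RootNominalsNotIntroduced σ
  branch-rootNominalsNotIntroduced (b-leaf _) fresh = fresh
  -- [◇] requires its new nominal not to occur yet, whereas the root's nominals occur from the start.
  branch-rootNominalsNotIntroduced {ρ} (b-step {a = applicable} branch) fresh =
    branch-rootNominalsNotIntroduced branch (rootNominalsNotIntroduced-++ fresh
      λ { refl j∈φ0 → proj₁ (proj₂ applicable) (root-nominal-occurs ρ j∈φ0) })
  branch-rootNominalsNotIntroduced (b-left branch) fresh =
    branch-rootNominalsNotIntroduced branch (rootNominalsNotIntroduced-++ fresh λ ())
  branch-rootNominalsNotIntroduced (b-right branch) fresh =
    branch-rootNominalsNotIntroduced branch (rootNominalsNotIntroduced-++ fresh λ ())

module BranchModel (i0 : ℕ) (φ0 : Form) (σ : List Rule) where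
  private
    root : LF
    root = i0 , φ0

    Θσ : List LF
    Θσ = Θ root σ

    nominals : List ℕ
    nominals = nomSeq root σ

    Occ : ℕ → Set
    Occ = Occurs root σ

    Twin : ℕ → ℕ → Set
    Twin = Twins root σ

  firstAt-exists : ∀ {l j} → j ∈ l → ∃[ n ] FirstAt root σ l j n
  firstAt-exists {k ∷ _} {j} j∈ with k ≟ j
  ... | yes refl = zero , here
  firstAt-exists (here refl)  | no k≢j = ⊥-elim (k≢j refl)
  firstAt-exists (there j∈l) | no k≢j = let n , f = firstAt-exists j∈l in suc n , there k≢j f

  firstAt-functional : ∀ {l j m n} → FirstAt root σ l j m → FirstAt root σ l j n → m ≡ n
  firstAt-functional here          here          = refl
  firstAt-functional here          (there j≢j _) = ⊥-elim (j≢j refl)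
  firstAt-functional (there j≢j _) here          = ⊥-elim (j≢j refl)
  firstAt-functional (there _ f)   (there _ g)   = cong suc (firstAt-functional f g)

  firstAt-injective : ∀ {l j k n} → FirstAt root σ l j n → FirstAt root σ l k n → j ≡ k
  firstAt-injective here        here        = refl
  firstAt-injective (there _ f) (there _ g) = firstAt-injective f g

  earlier? : ∀ {j k} → Occ j → Occ k → Dec (Earlier root σ j k)
  earlier? j∈ k∈ with firstAt-exists j∈ | firstAt-exists k∈
  ... | m , fj | n , fk =
    map′ (λ m<n → m , n , fj , fk , m<n)
         (λ { (_ , _ , fj′ , fk′ , m′<n′) →
                subst₂ _<_ (firstAt-functional fj′ fj) (firstAt-functional fk′ fk) m′<n′ })
         (m <? n)

  Twins-refl : ∀ {i} → Twin i i
  Twins-refl _ = ⇔-id _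

  Twins-sym : ∀ {i j} → Twin i j → Twin j i
  Twins-sym i~j φ = ⇔-sym (i~j φ)

  Twins-trans : ∀ {i j k} → Twin i j → Twin j k → Twin i k
  Twins-trans i~j j~k φ = j~k φ ⇔-∘ i~j φ

  T⊆? : ∀ i j → Dec (∀ φ → T root σ i φ → T root σ j φ)
  T⊆? i j =
    map′ (λ all φ (i:φ , φ≼φ0) → All.lookup all i:φ refl φ≼φ0 , φ≼φ0)
         (λ T⊆ → All.tabulate λ { {_ , φ} i:φ refl φ≼φ0 → proj₁ (T⊆ φ (i:φ , φ≼φ0)) })
         (all? (λ { (i′ , φ) → i′ ≟ i →-dec qsub? φ φ0 →-dec (j , φ) ∈ˡ? Θσ }) Θσ)

  twins? : Decidable Twin
  twins? i j = map′ (λ (i⊆j , j⊆i) φ → mk⇔ (i⊆j φ) (j⊆i φ))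
                    (λ i~j → (λ φ → Equivalence.to (i~j φ)) , (λ φ → Equivalence.from (i~j φ)))
                    (T⊆? i j ×-dec T⊆? j i)

  IsV-recompute : ∀ {i j} → Recomputable (IsV root σ i j)
  IsV-recompute {i} {j} v =
    i∈ , j∈ , recompute (twins? i j) (proj₁ (proj₂ (proj₂ v))) ,
    ¬-recompute (proj₁ (proj₂ (proj₂ (proj₂ v)))) ,
    λ k k∈ i~k qk k≢j → recompute (earlier? j∈ k∈) (proj₂ (proj₂ (proj₂ (proj₂ v))) k k∈ i~k qk k≢j)
    where
      i∈ : Occ i
      i∈ = recompute (i ∈? nominals) (proj₁ v)
      j∈ : Occ j
      j∈ = recompute (j ∈? nominals) (proj₁ (proj₂ v))

  IsV-twin : ∀ {i j} → IdentityUrfather root σ j → Occ i → Twin i j → IsV root σ i j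
  IsV-twin (j∈ , _ , _ , qj , earliest) i∈ i~j =
    i∈ , j∈ , i~j , qj , λ k k∈ i~k → earliest k k∈ (Twins-trans (Twins-sym i~j) i~k)

  _≟ʷ_ : DecidableEquality (WΘ root σ)
  world i _ ≟ʷ world j _ = map′ (λ { refl → refl }) (cong nomOf) (i ≟ j)

  LoopVia : ℕ → ℕ → ℕ → Set
  LoopVia w a b = (a , ◇ᶠ nm b) ∈ Θσ × Twin a w × Twin b w

  loopVia? : ∀ w a b → Dec (LoopVia w a b)
  loopVia? w a b = (a , ◇ᶠ nm b) ∈ˡ? Θσ ×-dec twins? a w ×-dec twins? b w

  reflexive⇔loop : ∀ w → RΘ root σ w w ⇔ Any (λ a → Any (LoopVia (nomOf w) a) nominals) nominals
  reflexive⇔loop (world w u) = mk⇔ loop reflexive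
    where
      loop : RΘ root σ (world w u) (world w u) → Any (λ a → Any (LoopVia w a) nominals) nominals
      loop (_ , _ , a◇b , inj₁ ((a∈ , _ , a~w , _) , (b∈ , _ , b~w , _))) =
        lose a∈ (lose b∈ (a◇b , a~w , b~w))
      loop (_ , _ , a◇b , inj₂ ((b∈ , _ , b~w , _) , (a∈ , _ , a~w , _))) =
        lose a∈ (lose b∈ (a◇b , a~w , b~w))
      reflexive : Any (λ a → Any (LoopVia w a) nominals) nominals → RΘ root σ (world w u) (world w u)
      reflexive loops =
        let a , a∈ , loops-a         = find loops
            b , b∈ , a◇b , a~w , b~w = find loops-a
            w-urfather               = IsV-recompute u
        in a , b , a◇b , inj₁ (IsV-twin w-urfather a∈ a~w , IsV-twin w-urfather b∈ b~w)

  reflexive? : ∀ w → Dec (RΘ root σ w w)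
  reflexive? w = map′ (Equivalence.from (reflexive⇔loop w)) (Equivalence.to (reflexive⇔loop w))
                     (any? (λ a → any? (loopVia? (nomOf w) a) nominals) nominals)

  quasiUrfather⇒¬¬inDom : ∀ {k} → Occ k → QuasiUrfather root σ k → ¬ ¬ InDom root σ k
  -- Without an identity urfather no candidate is earliest, so strong induction on the position
  -- of first occurrence excludes all candidates, k among them.
  quasiUrfather⇒¬¬inDom {k} k∈ qk ¬dom =
    no-candidate-at _ k (proj₂ (firstAt-exists k∈)) (k∈ , Twins-refl , qk)
    where
      Candidate : ℕ → Set
      Candidate j = Occ j × Twin k j × QuasiUrfather root σ j

      NoCandidateAt : ℕ → Set
      NoCandidateAt n = ∀ j → FirstAt root σ nominals j n → ¬ Candidate j

      no-candidate-at : ∀ n → NoCandidateAt n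
      no-candidate-at = <-rec NoCandidateAt no-candidate-step
        where
          no-candidate-step : ∀ n → (∀ {m} → m < n → NoCandidateAt m) → NoCandidateAt n
          no-candidate-step n none-earlier j fj (j∈ , k~j , qj) = ¬dom (j , k∈ , j∈ , k~j , qj , earliest)
            where
              earliest : ∀ k′ → Occ k′ → Twin k k′ → QuasiUrfather root σ k′ → k′ ≢ j
                       → Earlier root σ j k′
              earliest k′ k′∈ k~k′ qk′ k′≢j with firstAt-exists k′∈
              ... | m , fk′ with <-cmp n m
              ... | tri< n<m _ _  = n , m , fj , fk′ , n<m
              ... | tri≈ _ refl _ = ⊥-elim (k′≢j (firstAt-injective fk′ fj))
              ... | tri> _ _ m<n  = ⊥-elim (none-earlier m<n k′ fk′ (k′∈ , k~k′ , qk′))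

  module _ (fresh : RootNominalsNotIntroduced i0 φ0 σ) {k : ℕ} (k∈φ0 : k ∈ nomsF φ0) where

    ≺*-root-nominal : ∀ {j} → _≺*_ root σ j k → j ≡ k
    ≺*-root-nominal ε                     = refl
    ≺*-root-nominal ((ψ , r◇∈) ◅ j′≺*k) with ≺*-root-nominal j′≺*k
    ... | refl = ⊥-elim (fresh _ ψ k r◇∈ k∈φ0)

    root-nominal-quasiUrfather : QuasiUrfather root σ k
    root-nominal-quasiUrfather (_ , _ , j≢j′ , _ , j≺*k , j′≺*k) =
      j≢j′ (trans (≺*-root-nominal j≺*k) (sym (≺*-root-nominal j′≺*k)))

    root-nominal-¬¬inDom : ¬ ¬ InDom root σ k
    root-nominal-¬¬inDom =
      quasiUrfather⇒¬¬inDom (root-nominal-occurs i0 φ0 σ k∈φ0) root-nominal-quasiUrfather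

  twin-loop⇒closed : Saturated root σ → ∀ {a b k} → Sub (nm k) φ0 → Occ a → Occ k
                   → (a , ◇ᶠ nm b) ∈ Θσ → Twin a k → Twin b k → Closed root σ
  twin-loop⇒closed sat {a} {b} {k} k⊑φ0 a∈ k∈ a◇b a~k b~k = b , nm k , b:k , b:¬k
    where
      k:k : (k , nm k) ∈ Θσ
      k:k = All.head (sat (rRef k) k∈)
      twin-named-k : ∀ {c} → Twin c k → (c , nm k) ∈ Θσ
      twin-named-k c~k = proj₁ (Equivalence.from (c~k (nm k)) (k:k , inj₁ k⊑φ0))
      a:a : (a , nm a) ∈ Θσ
      a:a = All.head (sat (rRef a) a∈)
      k:a : (k , nm a) ∈ Θσ
      k:a = All.head (sat (rId a (nm a) k) (a:a , twin-named-k a~k , λ { (_ , _ , () , _) }))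
      k:¬◇k : (k , ¬ᶠ ◇ᶠ nm k) ∈ Θσ
      k:¬◇k = All.head (sat (rI k) k∈)
      a:¬◇k : (a , ¬ᶠ ◇ᶠ nm k) ∈ Θσ
      a:¬◇k = All.head (sat (rId k (¬ᶠ ◇ᶠ nm k) a) (k:¬◇k , k:a , λ { (_ , _ , () , _) }))
      b:¬k : (b , ¬ᶠ nm k) ∈ Θσ
      b:¬k = All.head (sat (r¬◇ a (nm k) b) (a:¬◇k , a◇b))
      b:k : (b , nm k) ∈ Θσ
      b:k = twin-named-k b~k

  root-nominal-irreflexive : ¬ Closed root σ → Saturated root σ → RootNominalsNotIntroduced i0 φ0 σ
                           → ∀ {k} → Sub (nm k) φ0 → NamesIrreflexive (MΘ root σ) k
  root-nominal-irreflexive _ _ fresh k⊑φ0 _ (inj₂ (¬dom , _)) _ =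
    root-nominal-¬¬inDom fresh (nominal-sub⇒∈nomsF k⊑φ0) ¬dom
  root-nominal-irreflexive ¬closed sat _ k⊑φ0 w (inj₁ (k∈ , _ , k~w , _)) wRw =
    let a , a∈ , loops-a         = find (Equivalence.to (reflexive⇔loop w) wRw)
        _ , _ , a◇b , a~w , b~w = find loops-a
        w~k                      = Twins-sym k~w
    in ¬closed (twin-loop⇒closed sat k⊑φ0 a∈ k∈ a◇b (Twins-trans a~w w~k) (Twins-trans b~w w~k))

lemma13 : ∀ (i0 : ℕ) (φ0 : Form) → ¬ (i0 ∈ nomsF φ0)
          → (t : Tableau (i0 , φ0) []) → ∀ σ → BranchOf (i0 , φ0) t σ
          → ¬ Closed (i0 , φ0) σ → Saturated (i0 , φ0) σ
          → ∀ i → (u : IdentityUrfather (i0 , φ0) σ i)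
          → ∀ φ → QSub φ φ0
          → ∀ (x : Bulldoze.WB (MΘ (i0 , φ0) σ))
          → Bulldoze.IsB (MΘ (i0 , φ0) σ) (world i u) x
          → (_⊨_ (MΘ (i0 , φ0) σ) (world i u) φ ⇔ _⊨_ (Bulldoze.MB (MΘ (i0 , φ0) σ)) x φ)
lemma13 i0 φ0 _ _ σ branch ¬closed sat i u φ φ≼φ0 x x-is-iB =
  subst (λ w → w ⊨ᴹ φ ⇔ x ⊨ᴮ φ) (α-IsB (MΘ (i0 , φ0) σ) x-is-iB)
        (⊨-bulldoze φ nominals-irreflexive x)
  where
    open BranchModel i0 φ0 σ
    open BulldozeTruth (MΘ (i0 , φ0) σ) _≟ʷ_ reflexive?

    fresh : RootNominalsNotIntroduced i0 φ0 σ
    fresh = branch-rootNominalsNotIntroduced i0 φ0 branch λ _ _ _ ()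

    nominals-irreflexive : NominalsIrreflexive (MΘ (i0 , φ0) σ) φ
    nominals-irreflexive k k⊑φ = root-nominal-irreflexive ¬closed sat fresh (qsub-nominal φ≼φ0 k⊑φ)
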